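{- For every positive integer $n$, $f(n)<8^n$.
   Context: An arithmetic formula for a positive integer $n$ is a full binary tree whose nodes carry positive integer values, such that: the root has value $n$; every leaf has value $1$; every non-leaf node is labelled $+$ (additive) or $\times$ (multiplicative); an additive node has value $a+b$ and a multiplicative node value $ab$, where $a,b$ are the values of its two children (order of children matters); both children of every multiplicative node have value at least $2$. $f(n)$ is the number of arithmetic formulas for $n$. -}

module Defs where

open import Data.Nat using (ℕ; suc; _+_; _*_; _≤_)

-- Arithmetic formulas: full binary trees with positive-integer node values,
-- root value n, leaves of value 1, internal nodes labelled + or ×,
-- ordered children, and both children of a × node of value ≥ 2.
-- `Formula n` is the type of arithmetic formulas for n (value of the root).
data Formula : ℕ → Set where
  leaf : Formula 1
  add  : ∀ {a b} → Formula a → Formula b → Formula (a + b)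
  mul  : ∀ {a b} → 2 ≤ a → 2 ≤ b → Formula a → Formula b → Formula (a * b)

module Submission where

-- Proof idea: an injective encoding of formulas into a short range of naturals.
--
-- 1. A formula is serialised in prefix (Polish) notation as a bit string:
--    a leaf becomes "0", a + node "10", a × node "11", each followed by the
--    serialisations of its two children.  Prefix notation is a prefix-free
--    code, so the serialisation is injective.
-- 2. Every formula for n has a serialisation of length at most 3n − 2: a node
--    costs two bits, and a × node is no longer than the + node with the same
--    children because a + b ≤ ab when a, b ≥ 2.
-- 3. Reading a bit string as a bijective base-2 numeral (digits 1 and 2) is
--    injective and sends strings of length L below 2^(L+1) − 1.  Hence the
--    "rank" of a formula for n is an injective value below 2^(3n−1) − 1 < 8^n − 1.
-- 4. A duplicate-free list whose elements are mapped injectively below K has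
--    length at most K (pigeonhole on Fin).  With K = 8^n − 1 this gives the
--    theorem.

open import Defs
open import Data.Nat using (ℕ; _^_; _<_; _≤_)
open import Data.List using (List; length)
open import Data.List.Relation.Unary.Unique.Propositional using (Unique)

open import Data.Nat using (suc; _+_; _*_; pred; z≤n; s≤s)
open import Data.Nat.Properties
open import Data.Nat.Tactic.RingSolver using (solve-∀)
open import Data.Bool using (Bool; true; false)
open import Data.List using ([]; _∷_; lookup)
open import Data.List.Properties using (∷-injectiveʳ)
open import Data.List.Relation.Unary.All using (All; _∷_)
open import Data.List.Relation.Unary.AllPairs using (_∷_)
open import Data.Fin using (Fin; fromℕ<; toℕ)
import Data.Fin as Fin
open import Data.Fin.Properties using (injective⇒≤; toℕ-fromℕ<)
open import Data.Product using (Σ; _,_; _×_)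
open import Data.Empty using (⊥-elim)
open import Relation.Nullary using (¬_)
open import Relation.Binary.PropositionalEquality

-- Serialisation of a formula in prefix notation, written in front of a given
-- continuation r (so that concatenation never has to be reassociated).
serialise : ∀ {n} → Formula n → List Bool → List Bool
serialise leaf          r = false ∷ r
serialise (add f g)     r = true ∷ false ∷ serialise f (serialise g r)
serialise (mul _ _ f g) r = true ∷ true ∷ serialise f (serialise g r)

serialise-injective : ∀ {a b} (f : Formula a) (g : Formula b) {r s : List Bool} →
  serialise f r ≡ serialise g s → (_≡_ {A = Σ ℕ Formula} (a , f) (b , g)) × r ≡ s
serialise-injective leaf leaf e = refl , ∷-injectiveʳ e
serialise-injective (add f₁ f₂) (add g₁ g₂) e
  with refl , e₂ ← serialise-injective f₁ g₁ (∷-injectiveʳ (∷-injectiveʳ e))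
  with refl , refl ← serialise-injective f₂ g₂ e₂ = refl , refl
serialise-injective (mul p₁ p₂ f₁ f₂) (mul q₁ q₂ g₁ g₂) e
  with refl , e₂ ← serialise-injective f₁ g₁ (∷-injectiveʳ (∷-injectiveʳ e))
  with refl , refl ← serialise-injective f₂ g₂ e₂
  rewrite ≤-irrelevant p₁ q₁ | ≤-irrelevant p₂ q₂ = refl , refl
serialise-injective leaf (add _ _) ()
serialise-injective leaf (mul _ _ _ _) ()
serialise-injective (add _ _) leaf ()
serialise-injective (add _ _) (mul _ _ _ _) ()
serialise-injective (mul _ _ _ _) leaf ()
serialise-injective (mul _ _ _ _) (add _ _) ()

-- For factors at least 2, the sum is bounded by the product; this is why a
-- × node never needs more bits than its value allows.
+≤* : ∀ {a b} → 2 ≤ a → 2 ≤ b → a + b ≤ a * b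
+≤* {suc (suc x)} {suc (suc y)} (s≤s (s≤s z≤n)) (s≤s (s≤s z≤n)) =
  ≤-trans (m≤m+n (2 + x + (2 + y)) (x + y + x * y)) (≤-reflexive (expand x y))
  where
  expand : ∀ x y → 2 + x + (2 + y) + (x + y + x * y) ≡ (2 + x) * (2 + y)
  expand = solve-∀

-- Length bound: a formula for n occupies at most 3n − 2 bits.  The two
-- bits of a node plus the bounds for its children fit in 3(a + b).
serialise-length : ∀ {n} (f : Formula n) (r : List Bool) →
  2 + length (serialise f r) ≤ 3 * n + length r
children-length : ∀ {a b} (f : Formula a) (g : Formula b) (r : List Bool) →
  2 + (2 + length (serialise f (serialise g r))) ≤ 3 * (a + b) + length r

serialise-length leaf                  r = ≤-refl
serialise-length (add f g)             r = children-length f g r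
serialise-length (mul {a} {b} p q f g) r =
  ≤-trans (children-length f g r) (+-monoˡ-≤ (length r) (*-monoʳ-≤ 3 (+≤* p q)))

children-length {a} {b} f g r = begin
  2 + (2 + length (serialise f (serialise g r)))
    ≤⟨ +-monoʳ-≤ 2 (serialise-length f (serialise g r)) ⟩
  2 + (3 * a + length (serialise g r))
    ≡⟨ shuffle (3 * a) (length (serialise g r)) ⟩
  3 * a + (2 + length (serialise g r))
    ≤⟨ +-monoʳ-≤ (3 * a) (serialise-length g r) ⟩
  3 * a + (3 * b + length r)
    ≡⟨ regroup a b (length r) ⟩
  3 * (a + b) + length r ∎
  where
  open ≤-Reasoning
  shuffle : ∀ x y → 2 + (x + y) ≡ x + (2 + y)
  shuffle = solve-∀
  regroup : ∀ a b l → 3 * a + (3 * b + l) ≡ 3 * (a + b) + l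
  regroup = solve-∀

code : ∀ {n} → Formula n → List Bool
code f = serialise f []

code-injective : ∀ {n} {f g : Formula n} → code f ≡ code g → f ≡ g
code-injective {f = f} {g} e with refl , _ ← serialise-injective f g e = refl

code-length : ∀ {n} (f : Formula n) → 2 + length (code f) ≤ 3 * n
code-length {n} f = subst (2 + length (code f) ≤_) (+-identityʳ (3 * n)) (serialise-length f [])

-- Bit strings read as bijective base-2 numerals, least significant digit first
-- (false is digit 1, true is digit 2): a bijection List Bool ≅ ℕ.
bits→ℕ : List Bool → ℕ
bits→ℕ []           = 0
bits→ℕ (false ∷ bs) = 1 + 2 * bits→ℕ bs
bits→ℕ (true ∷ bs)  = 2 + 2 * bits→ℕ bs

bits→ℕ-injective : ∀ {xs ys} → bits→ℕ xs ≡ bits→ℕ ys → xs ≡ ys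
bits→ℕ-injective {[]}         {[]}         e = refl
bits→ℕ-injective {false ∷ xs} {false ∷ ys} e =
  cong (false ∷_) (bits→ℕ-injective (*-cancelˡ-≡ (bits→ℕ xs) (bits→ℕ ys) 2 (suc-injective e)))
bits→ℕ-injective {true ∷ xs}  {true ∷ ys}  e =
  cong (true ∷_)
    (bits→ℕ-injective (*-cancelˡ-≡ (bits→ℕ xs) (bits→ℕ ys) 2 (suc-injective (suc-injective e))))
bits→ℕ-injective {false ∷ xs} {true ∷ ys}  e = ⊥-elim (even≢odd (bits→ℕ xs) (bits→ℕ ys) (suc-injective e))
bits→ℕ-injective {true ∷ xs}  {false ∷ ys} e = ⊥-elim (even≢odd (bits→ℕ ys) (bits→ℕ xs) (sym (suc-injective e)))
bits→ℕ-injective {[]}         {false ∷ _}  ()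
bits→ℕ-injective {[]}         {true ∷ _}   ()
bits→ℕ-injective {false ∷ _}  {[]}         ()
bits→ℕ-injective {true ∷ _}   {[]}         ()

-- A string of length L is read as a number below 2^(L+1) − 1 (the numbers of
-- at most L digits).
bits→ℕ-bound : ∀ bs → 2 + bits→ℕ bs ≤ 2 ^ suc (length bs)
bits→ℕ-bound []       = ≤-refl
bits→ℕ-bound (b ∷ bs) = ≤-trans (digit b) (*-monoʳ-≤ 2 (bits→ℕ-bound bs))
  where
  twice : ∀ x → 2 + (2 + 2 * x) ≡ 2 * (2 + x)
  twice = solve-∀
  digit : ∀ b → 2 + bits→ℕ (b ∷ bs) ≤ 2 * (2 + bits→ℕ bs)
  digit false = ≤-trans (n≤1+n _) (≤-reflexive (twice (bits→ℕ bs)))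
  digit true  = ≤-reflexive (twice (bits→ℕ bs))

lookup-injective : ∀ {A : Set} {xs : List A} → Unique xs →
  ∀ i j → lookup xs i ≡ lookup xs j → i ≡ j
lookup-injective (_ ∷ u)  Fin.zero    Fin.zero    _ = refl
lookup-injective (x∉ ∷ _) Fin.zero    (Fin.suc j) e = ⊥-elim (differs x∉ j e)
  where
  differs : ∀ {A : Set} {x : A} {ys} → All (λ y → ¬ x ≡ y) ys → ∀ j → ¬ x ≡ lookup ys j
  differs (x≢y ∷ _)   Fin.zero    = x≢y
  differs (_ ∷ x≢ys) (Fin.suc j) = differs x≢ys j
lookup-injective u@(_ ∷ _) (Fin.suc i) Fin.zero e = sym (lookup-injective u Fin.zero (Fin.suc i) (sym e))
lookup-injective (_ ∷ u)  (Fin.suc i) (Fin.suc j) e = cong Fin.suc (lookup-injective u i j e)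

unique-length-≤ : ∀ {A : Set} {xs : List A} → Unique xs → (h : A → ℕ) →
  (∀ {x y} → h x ≡ h y → x ≡ y) → ∀ K → (∀ x → h x < K) → length xs ≤ K
unique-length-≤ {xs = xs} u h h-inj K h<K = injective⇒≤ {f = index} index-injective
  where
  index : Fin (length xs) → Fin K
  index i = fromℕ< (h<K (lookup xs i))
  index-injective : ∀ {i j} → index i ≡ index j → i ≡ j
  index-injective {i} {j} e = lookup-injective u i j (h-inj (begin
    h (lookup xs i)       ≡⟨ toℕ-fromℕ< (h<K (lookup xs i)) ⟨
    toℕ (index i)         ≡⟨ cong toℕ e ⟩
    toℕ (index j)         ≡⟨ toℕ-fromℕ< (h<K (lookup xs j)) ⟩
    h (lookup xs j)       ∎))
    where open ≡-Reasoning

rank : ∀ {n} → Formula n → ℕ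
rank f = bits→ℕ (code f)

rank-injective : ∀ {n} {f g : Formula n} → rank f ≡ rank g → f ≡ g
rank-injective e = code-injective (bits→ℕ-injective e)

rank-bound : ∀ {n} (f : Formula n) → 2 + rank f ≤ 8 ^ n
rank-bound {n} f = begin
  2 + rank f                 ≤⟨ bits→ℕ-bound (code f) ⟩
  2 ^ (1 + length (code f))  ≤⟨ ^-monoʳ-≤ 2 (≤-trans (n≤1+n _) (code-length f)) ⟩
  2 ^ (3 * n)                ≡⟨ ^-*-assoc 2 3 n ⟨
  8 ^ n                      ∎
  where open ≤-Reasoning

lemma3p2 : (n : ℕ) → 1 ≤ n → (xs : List (Formula n)) → Unique xs → length xs < 8 ^ n
lemma3p2 n _ xs u = m≤pred[n]⇒suc[m]≤n {{m^n≢0 8 n}} length≤8^n-1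
  where
  rank<8^n-1 : ∀ (f : Formula n) → rank f < pred (8 ^ n)
  rank<8^n-1 f = suc[m]≤n⇒m≤pred[n] (rank-bound f)
  length≤8^n-1 : length xs ≤ pred (8 ^ n)
  length≤8^n-1 = unique-length-≤ u rank rank-injective (pred (8 ^ n)) rank<8^n-1
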